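{- Let $t\ge 1$ be an integer and let $G$ be a connected $P_t$-free graph with $n$ vertices. Then $G$ has a $\frac{1}{2t}$-heavy vertex; that is, there is a vertex $w\in V(G)$ such that for at least $\frac{1}{2t}\binom{n}{2}$ unordered pairs $\{u,v\}$ of distinct vertices of $G$, the closed neighborhood $N[w]$ intersects at least $\frac{1}{2t}\cdot|\mathcal{B}_{u,v}|$ of the paths in $\mathcal{B}_{u,v}$.
   Context: $P_t$ is the path on $t$ vertices; a graph is $P_t$-free if it has no induced subgraph isomorphic to $P_t$. For distinct vertices $u,v$, the bucket $\mathcal{B}_{u,v}$ is the set of all induced paths in $G$ whose two endvertices are $u$ and $v$. $N[w]$ denotes the closed neighborhood of $w$ (the vertex $w$ together with its neighbors). For $\varepsilon>0$, a vertex $w$ $\varepsilon$-hits $\mathcal{B}_{u,v}$ if $N[w]$ intersects at least $\varepsilon|\mathcal{B}_{u,v}|$ paths of $\mathcal{B}_{u,v}$, and $w$ is $\varepsilon$-heavy if it $\varepsilon$-hits at least $\varepsilon\binom{|V(G)|}{2}$ buckets. -}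

module Defs where

open import Data.Nat using (ℕ; zero; suc; _<_; _≤_; _*_; _+_)
open import Data.Bool using (Bool; true; false; _∧_; _∨_; not; T)
open import Data.Fin using (Fin; toℕ)
open import Data.Fin.Properties using (_≟_)
open import Data.List using (List; []; _∷_; [_]; length; filter; map; concatMap; concat; allFin; upTo)
open import Data.Bool.ListAction using (any; all)
open import Data.Product using (Σ; _×_; ∃)
open import Relation.Binary.PropositionalEquality using (_≡_)
open import Relation.Nullary using (¬_)
open import Relation.Nullary.Decidable using (⌊_⌋)
open import Data.Nat.Combinatorics using (_C_)

record SimpleGraph (n : ℕ) : Set where
  field
    adj     : Fin n → Fin n → Bool
    adj-sym : ∀ u v → adj u v ≡ adj v u
    adj-irr : ∀ v → adj v v ≡ false
open SimpleGraph public

open import Relation.Nullary using (Dec; yes; no)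

T? : (b : Bool) → Dec (T b)
T? true  = yes _
T? false = no (λ ())

module _ {n : ℕ} (G : SimpleGraph n) where

  _=ᵇ_ : Fin n → Fin n → Bool
  x =ᵇ y = ⌊ x ≟ y ⌋

  isWalk : List (Fin n) → Bool
  isWalk []           = false
  isWalk (x ∷ [])     = true
  isWalk (x ∷ y ∷ xs) = adj G x y ∧ isWalk (y ∷ xs)

  isInducedPath : List (Fin n) → Bool
  isInducedPath []       = false
  isInducedPath (x ∷ []) = true
  isInducedPath (x ∷ y ∷ xs) =
    not (any (x =ᵇ_) (y ∷ xs)) ∧ adj G x y ∧
    all (λ z → not (adj G x z)) xs ∧ isInducedPath (y ∷ xs)

  startsAt : Fin n → List (Fin n) → Bool
  startsAt u []      = false
  startsAt u (x ∷ _) = u =ᵇ x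

  endsAt : Fin n → List (Fin n) → Bool
  endsAt v []           = false
  endsAt v (x ∷ [])     = v =ᵇ x
  endsAt v (x ∷ y ∷ xs) = endsAt v (y ∷ xs)

  listsOfLength : ℕ → List (List (Fin n))
  listsOfLength zero    = [ [] ]
  listsOfLength (suc k) = concatMap (λ xs → map (_∷ xs) (allFin n)) (listsOfLength k)

  -- all lists of length at most n (each exactly once); every induced path
  -- has at most n (distinct) vertices, so this contains all of them.
  candidates : List (List (Fin n))
  candidates = concat (map listsOfLength (upTo (suc n)))

  -- The bucket B_{u,v}: induced paths with endvertices u and v.  For u ≠ v
  -- each such path is represented exactly once, as its sequence from u to v.
  bucket : Fin n → Fin n → List (List (Fin n))
  bucket u v = filter (λ p → T? (isInducedPath p ∧ startsAt u p ∧ endsAt v p)) candidates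

  closedNbhdMeets : Fin n → List (Fin n) → Bool
  closedNbhdMeets w p = any (λ x → (w =ᵇ x) ∨ adj G w x) p

  hitCount : Fin n → Fin n → Fin n → ℕ
  hitCount w u v = length (filter (λ p → T? (closedNbhdMeets w p)) (bucket u v))

  -- w (1/(2t))-hits B_{u,v}:  hitCount ≥ |B_{u,v}| / (2t), i.e. 2t·hitCount ≥ |B_{u,v}|
  hits : ℕ → Fin n → Fin n → Fin n → Set
  hits t w u v = length (bucket u v) ≤ (2 * t) * hitCount w u v

  -- number of unordered pairs {u,v} (u ≠ v, represented with u < v) whose bucket w hits
  hitBucketCount : ℕ → Fin n → ℕ
  hitBucketCount t w =
    length (filter (λ uv → P? (Data.Product.proj₁ uv) (Data.Product.proj₂ uv))
                   (concatMap (λ u → map (λ v → (u , v)) (allFin n)) (allFin n)))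
    where
      open import Data.Product using (_,_)
      import Data.Nat as N
      open import Relation.Nullary.Decidable using (_×-dec_)
      P? : (u v : Fin n) → Dec (toℕ u < toℕ v × hits t w u v)
      P? u v = (toℕ u N.<? toℕ v) ×-dec (length (bucket u v) N.≤? (2 * t) * hitCount w u v)

  heavy : ℕ → Fin n → Set
  heavy t w = n C 2 ≤ (2 * t) * hitBucketCount t w

  Connected : Set
  Connected = ∀ u v → Σ (List (Fin n)) λ p →
    T (isWalk p) × T (startsAt u p) × T (endsAt v p)

  PFree : ℕ → Set
  PFree t = ∀ p → T (isInducedPath p) → ¬ (length p ≡ t)

-- Gyárfás' path argument.  Call a component of G − X big if it has more than
-- (n + 1)/2 vertices; G − X has at most one.  Grow an induced path x₁ … x_k,
-- keeping a vertex of N[x_k] in the big component of G − N[x₁ … x_{k-1}].  While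
-- G − N[x₁ … x_k] still has a big component, a path from that vertex into it
-- leaves N[x₁ … x_k] for the last time at some x ∈ N(x_k) ∖ N[x₁ … x_{k-1}], and
-- x extends the induced path.  Since G is P_t-free this stops with k ≤ t.  Then
-- all components of G − N[x₁ … x_k] are small, so at least half of the pairs
-- u < v are separated by N[x₁ … x_k]; every induced u–v path of a separated pair
-- meets some N[x_i], so some x_i hits a 1/t fraction of that bucket, and
-- averaging over the x_i once more gives a heavy vertex.
-- Reachability in G − X is decided only under double negation, which suffices
-- because heaviness is decidable.
module Submission where

open import Defs
open import Data.Bool using (Bool; true; false; _∧_; _∨_; not; T)
open import Data.Bool.Properties using (T-∧; T-∨)
open import Data.Bool.ListAction using (any; all)
open import Data.Empty using (⊥; ⊥-elim)
open import Data.Unit using (tt)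
open import Data.Fin using (Fin; zero; suc; toℕ; fromℕ<)
import Data.Fin.Properties as Fin
open import Data.List using (List; []; _∷_; _++_; length; filter; map; concatMap; allFin)
open import Data.List.Properties using (length-++; filter-++; filter-none; filter-all; length-filter; length-tabulate)
open import Data.List.Extrema.Nat using (argmax; argmax-all; f[⊥]≤f[argmax]; f[xs]≤f[argmax])
open import Data.List.Membership.Propositional using (_∈_; lose)
open import Data.List.Membership.Propositional.Properties using (∈-allFin)
open import Data.List.Relation.Unary.All as All using (All; []; _∷_)
open import Data.List.Relation.Unary.All.Properties using (all-filter; ¬Any⇒All¬; all⁻)
open import Data.List.Relation.Unary.Any as Any using (Any; here; there)
open import Data.List.Relation.Unary.Any.Properties using (any⁺; any⁻) renaming (swap to Any-swap)
open import Data.List.Relation.Unary.Unique.Propositional using (Unique)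
open import Data.List.Relation.Unary.AllPairs using (_∷_)
open import Data.List.Relation.Unary.Unique.Propositional.Properties using (allFin⁺)
open import Data.Nat using (ℕ; zero; suc; _+_; _*_; _∸_; _≤_; _<_; z≤n; s≤s; _≤?_; _<?_)
open import Data.Nat.Properties
open import Algebra.Properties.CommutativeSemigroup +-commutativeSemigroup using (interchange)
open import Data.Nat.Combinatorics using (_C_; nC1≡n; nCk+nC[k+1]≡[n+1]C[k+1])
open import Data.Nat.Tactic.RingSolver using (solve-∀)
open import Data.Product using (Σ; ∃-syntax; _×_; _,_; proj₁; proj₂; swap)
open import Data.Sum using (_⊎_; inj₁; inj₂; [_,_])
open import Function using (_∘_; Equivalence)
open import Relation.Binary using (tri<; tri≈; tri>; DecidableEquality)
open import Relation.Binary.PropositionalEquality hiding ([_])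
open import Relation.Nullary using (Dec; yes; no; ¬_; contradiction)
open import Relation.Nullary.Decidable using (_×-dec_; toWitness; fromWitness; decidable-stable; ¬¬-excluded-middle)
open import Level using (0ℓ)
open import Relation.Unary using (Pred; Decidable; _⊆_)
open import Relation.Unary.Properties using (_∪?_; _∩?_; ∁?)

open Equivalence using (to; from)

indicator : {P : Set} → Dec P → ℕ
indicator (yes _) = 1
indicator (no _)  = 0

sumBy : {A : Set} → (A → ℕ) → List A → ℕ
sumBy f []       = 0
sumBy f (x ∷ xs) = f x + sumBy f xs

count : {A : Set} {P : Pred A 0ℓ} → Decidable P → List A → ℕ
count P? xs = length (filter P? xs)

module _ {A : Set} where

  sumBy-cong : {f g : A → ℕ} → (∀ x → f x ≡ g x) → ∀ xs → sumBy f xs ≡ sumBy g xs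
  sumBy-cong f≗g []       = refl
  sumBy-cong f≗g (x ∷ xs) = cong₂ _+_ (f≗g x) (sumBy-cong f≗g xs)

  sumBy-mono : {f g : A → ℕ} → ∀ {xs} → All (λ x → f x ≤ g x) xs → sumBy f xs ≤ sumBy g xs
  sumBy-mono []             = z≤n
  sumBy-mono (fx≤gx ∷ f≤g) = +-mono-≤ fx≤gx (sumBy-mono f≤g)

  sumBy-+ : (f g : A → ℕ) → ∀ xs → sumBy (λ x → f x + g x) xs ≡ sumBy f xs + sumBy g xs
  sumBy-+ f g []       = refl
  sumBy-+ f g (x ∷ xs) = trans (cong (f x + g x +_) (sumBy-+ f g xs)) (interchange (f x) (g x) _ _)

  *-distribˡ-sumBy : (k : ℕ) (f : A → ℕ) → ∀ xs → k * sumBy f xs ≡ sumBy (λ x → k * f x) xs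
  *-distribˡ-sumBy k f []       = *-zeroʳ k
  *-distribˡ-sumBy k f (x ∷ xs) = trans (*-distribˡ-+ k (f x) _) (cong (k * f x +_) (*-distribˡ-sumBy k f xs))

  sumBy≤length* : {f : A → ℕ} {c : ℕ} → ∀ {xs} → All (λ x → f x ≤ c) xs → sumBy f xs ≤ length xs * c
  sumBy≤length* []           = z≤n
  sumBy≤length* (fx≤c ∷ fxs≤c) = +-mono-≤ fx≤c (sumBy≤length* fxs≤c)

  sumBy-const : (c : ℕ) (xs : List A) → sumBy (λ _ → c) xs ≡ length xs * c
  sumBy-const c []       = refl
  sumBy-const c (x ∷ xs) = cong (c +_) (sumBy-const c xs)

  module _ {P : Pred A 0ℓ} (P? : Decidable P) where

    count≡sumBy-indicator : ∀ xs → count P? xs ≡ sumBy (indicator ∘ P?) xs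
    count≡sumBy-indicator []       = refl
    count≡sumBy-indicator (x ∷ xs) with P? x
    ... | yes _ = cong suc (count≡sumBy-indicator xs)
    ... | no _  = count≡sumBy-indicator xs

    count-universal : (∀ x → P x) → ∀ xs → count P? xs ≡ length xs
    count-universal all-P xs = cong length (filter-all P? (All.universal all-P xs))

    count-map : {B : Set} (f : B → A) → ∀ xs → count P? (map f xs) ≡ count (P? ∘ f) xs
    count-map f []       = refl
    count-map f (x ∷ xs) with P? (f x)
    ... | yes _ = cong suc (count-map f xs)
    ... | no _  = count-map f xs

    count-concatMap : {B : Set} (f : B → List A) → ∀ xs → count P? (concatMap f xs) ≡ sumBy (count P? ∘ f) xs
    count-concatMap f []       = refl
    count-concatMap f (x ∷ xs) = begin
      length (filter P? (f x ++ concatMap f xs))               ≡⟨ cong length (filter-++ P? (f x) _) ⟩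
      length (filter P? (f x) ++ filter P? (concatMap f xs))   ≡⟨ length-++ (filter P? (f x)) ⟩
      count P? (f x) + count P? (concatMap f xs)                         ≡⟨ cong (count P? (f x) +_) (count-concatMap f xs) ⟩
      count P? (f x) + sumBy (count P? ∘ f) xs                           ∎
      where open ≡-Reasoning

  module _ {P Q : Pred A 0ℓ} (P? : Decidable P) (Q? : Decidable Q) where

    count-mono : P ⊆ Q → ∀ xs → count P? xs ≤ count Q? xs
    count-mono P⊆Q []       = z≤n
    count-mono P⊆Q (x ∷ xs) with P? x | Q? x
    ... | yes _  | yes _  = s≤s (count-mono P⊆Q xs)
    ... | yes px | no ¬qx = contradiction (P⊆Q px) ¬qx
    ... | no _   | yes _  = m≤n⇒m≤1+n (count-mono P⊆Q xs)
    ... | no _   | no _   = count-mono P⊆Q xs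

    count-∪ : ∀ xs → count (P? ∪? Q?) xs ≤ count P? xs + count Q? xs
    count-∪ []       = z≤n
    count-∪ (x ∷ xs) with P? x | Q? x
    ... | yes _ | yes _ = s≤s (≤-trans (count-∪ xs) (+-monoʳ-≤ (count P? xs) (n≤1+n _)))
    ... | yes _ | no _  = s≤s (count-∪ xs)
    ... | no _  | yes _ = subst (count (P? ∪? Q?) xs <_) (sym (+-suc (count P? xs) (count Q? xs))) (s≤s (count-∪ xs))
    ... | no _  | no _  = count-∪ xs

    count-∪-disjoint : (∀ {x} → P x → ¬ Q x) → ∀ xs → count P? xs + count Q? xs ≤ count (P? ∪? Q?) xs
    count-∪-disjoint P∩Q=∅ []       = z≤n
    count-∪-disjoint P∩Q=∅ (x ∷ xs) with P? x | Q? x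
    ... | yes px | yes qx = contradiction qx (P∩Q=∅ px)
    ... | yes _  | no _   = s≤s (count-∪-disjoint P∩Q=∅ xs)
    ... | no _   | yes _  = subst (_≤ suc (count (P? ∪? Q?) xs)) (sym (+-suc (count P? xs) (count Q? xs))) (s≤s (count-∪-disjoint P∩Q=∅ xs))
    ... | no _   | no _   = count-∪-disjoint P∩Q=∅ xs

  module _ (_≟_ : DecidableEquality A) where

    count-≟-unique : ∀ {x xs} → Unique xs → x ∈ xs → count (x ≟_) xs ≡ 1
    count-≟-unique {x} (x≢xs ∷ _) (here refl) with x ≟ x
    ... | yes _   = cong suc (cong length (filter-none (x ≟_) x≢xs))
    ... | no x≢x  = contradiction refl x≢x
    count-≟-unique {x} {y ∷ _} (y≢ys ∷ uniq) (there x∈ys) with x ≟ y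
    ... | yes refl = contradiction refl (All.lookup y≢ys x∈ys)
    ... | no _     = count-≟-unique uniq x∈ys

module _ {A B : Set} where

  sumBy-swap : (f : A → B → ℕ) → ∀ xs ys →
               sumBy (λ x → sumBy (f x) ys) xs ≡ sumBy (λ y → sumBy (λ x → f x y) xs) ys
  sumBy-swap f []       ys = sym (trans (sumBy-const 0 ys) (*-zeroʳ (length ys)))
  sumBy-swap f (x ∷ xs) ys = trans (cong (sumBy (f x) ys +_) (sumBy-swap f xs ys))
                                   (sym (sumBy-+ (f x) (λ y → sumBy (λ x → f x y) xs) ys))

  module _ {P : Pred A 0ℓ} {Q : B → Pred A 0ℓ} (P? : Decidable P) (Q? : ∀ b → Decidable (Q b)) where

    count≤sumBy-count : (bs : List B) → ∀ {xs} → All (λ x → P x → Any (λ b → Q b x) bs) xs →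
                        count P? xs ≤ sumBy (λ b → count (Q? b) xs) bs
    count≤sumBy-count bs {xs} covered = begin
      count P? xs                                                 ≡⟨ count≡sumBy-indicator P? xs ⟩
      sumBy (indicator ∘ P?) xs                                   ≤⟨ sumBy-mono (All.map (λ {x} → covered-once (P? x)) covered) ⟩
      sumBy (λ x → sumBy (λ b → indicator (Q? b x)) bs) xs        ≡⟨ sumBy-swap (λ x b → indicator (Q? b x)) xs bs ⟩
      sumBy (λ b → sumBy (λ x → indicator (Q? b x)) xs) bs        ≡⟨ sumBy-cong (λ b → count≡sumBy-indicator (Q? b) xs) bs ⟨
      sumBy (λ b → count (Q? b) xs) bs                            ∎
      where
      open ≤-Reasoning
      witnessed : ∀ {x bs} → Any (λ b → Q b x) bs → 1 ≤ sumBy (λ b → indicator (Q? b x)) bs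
      witnessed {x} {b ∷ _} (here qbx) with Q? b x
      ... | yes _   = s≤s z≤n
      ... | no ¬qbx = contradiction qbx ¬qbx
      witnessed {x} {b ∷ _} (there q) = m≤n⇒m≤o+n (indicator (Q? b x)) (witnessed q)
      covered-once : ∀ {x} (p : Dec (P x)) → (P x → Any (λ b → Q b x) bs) → indicator p ≤ sumBy (λ b → indicator (Q? b x)) bs
      covered-once (yes px) cover = witnessed (cover px)
      covered-once (no _)   _     = z≤n

argmax∈ : {B : Set} (f : B → ℕ) (b : B) (bs : List B) → argmax f b bs ∈ b ∷ bs
argmax∈ f b bs = argmax-all f (here refl) (All.tabulate there)

sumBy≤length*argmax : {B : Set} (f : B → ℕ) (b : B) (bs : List B) → sumBy f (b ∷ bs) ≤ length (b ∷ bs) * f (argmax f b bs)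
sumBy≤length*argmax f b bs = sumBy≤length* (f[⊥]≤f[argmax] {f = f} b bs ∷ f[xs]≤f[argmax] {f = f} b bs)

halves-overlap : ∀ {n c c′} → suc n < 2 * c → suc n < 2 * c′ → ¬ (c + c′ ≤ n)
halves-overlap {n} {c} {c′} big big′ c+c′≤n = <-irrefl refl (begin-strict
  suc n + suc n   <⟨ +-mono-< big big′ ⟩
  2 * c + 2 * c′  ≡⟨ *-distribˡ-+ 2 c c′ ⟨
  2 * (c + c′)    ≤⟨ *-monoʳ-≤ 2 (≤-trans c+c′≤n (n≤1+n n)) ⟩
  2 * suc n       ≡⟨ double (suc n) ⟩
  suc n + suc n   ∎)
  where
  open ≤-Reasoning
  double : ∀ m → 2 * m ≡ m + m
  double = solve-∀

half-bound : ∀ {c g b} → c ≤ g + b → b + b ≤ c → c ≤ 2 * g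
half-bound {c} {g} {b} c≤g+b 2b≤c = +-cancelʳ-≤ c c (2 * g) (begin
  c + c             ≤⟨ +-mono-≤ c≤g+b c≤g+b ⟩
  (g + b) + (g + b) ≡⟨ regroup g b ⟩
  2 * g + (b + b)   ≤⟨ +-monoʳ-≤ (2 * g) 2b≤c ⟩
  2 * g + c         ∎)
  where
  open ≤-Reasoning
  regroup : ∀ g b → (g + b) + (g + b) ≡ 2 * g + (b + b)
  regroup = solve-∀

2*nC2+n≡n*n : ∀ n → 2 * (n C 2) + n ≡ n * n
2*nC2+n≡n*n zero    = refl
2*nC2+n≡n*n (suc n) = begin
  2 * (suc n C 2) + suc n         ≡⟨ cong (λ c → 2 * c + suc n) (nCk+nC[k+1]≡[n+1]C[k+1] n 1) ⟨
  2 * (n C 1 + n C 2) + suc n     ≡⟨ cong (λ c → 2 * (c + n C 2) + suc n) (nC1≡n n) ⟩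
  2 * (n + n C 2) + suc n         ≡⟨ regroup n (n C 2) ⟩
  (2 * (n C 2) + n) + (n + suc n) ≡⟨ cong (_+ (n + suc n)) (2*nC2+n≡n*n n) ⟩
  n * n + (n + suc n)             ≡⟨ square-suc n ⟩
  suc n * suc n                   ∎
  where
  open ≡-Reasoning
  regroup : ∀ n c → 2 * (n + c) + suc n ≡ (2 * c + n) + (n + suc n)
  regroup = solve-∀
  square-suc : ∀ n → n * n + (n + suc n) ≡ suc n * suc n
  square-suc = solve-∀

module _ {n : ℕ} where

  private
    V = Fin n
    vertices = allFin n

  length-vertices : length vertices ≡ n
  length-vertices = length-tabulate (λ v → v)

  count-≟-vertices : ∀ u → count (u Fin.≟_) vertices ≡ 1
  count-≟-vertices u = count-≟-unique Fin._≟_ (allFin⁺ n) (∈-allFin u)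

  sumBy-vertices-const : (c : ℕ) → sumBy (λ (_ : V) → c) vertices ≡ n * c
  sumBy-vertices-const c = trans (sumBy-const c vertices) (cong (_* c) length-vertices)

  pairs : List (V × V)
  pairs = concatMap (λ u → map (λ v → (u , v)) vertices) vertices

  count-pairs : {P : Pred (V × V) 0ℓ} (P? : Decidable P) →
                count P? pairs ≡ sumBy (λ u → count (λ v → P? (u , v)) vertices) vertices
  count-pairs P? = trans (count-concatMap P? _ vertices) (sumBy-cong (λ u → count-map P? (u ,_) vertices) vertices)

  count-pairs-swap : {P : Pred (V × V) 0ℓ} (P? : Decidable P) → count (P? ∘ swap) pairs ≡ count P? pairs
  count-pairs-swap P? = begin
    count (P? ∘ swap) pairs                                               ≡⟨ count-pairs (P? ∘ swap) ⟩
    sumBy (λ u → count (λ v → P? (v , u)) vertices) vertices              ≡⟨ sumBy-cong (λ u → count≡sumBy-indicator _ vertices) vertices ⟩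
    sumBy (λ u → sumBy (λ v → indicator (P? (v , u))) vertices) vertices  ≡⟨ sumBy-swap (λ u v → indicator (P? (v , u))) vertices vertices ⟩
    sumBy (λ v → sumBy (λ u → indicator (P? (v , u))) vertices) vertices  ≡⟨ sumBy-cong (λ v → count≡sumBy-indicator _ vertices) vertices ⟨
    sumBy (λ v → count (λ u → P? (v , u)) vertices) vertices              ≡⟨ count-pairs P? ⟨
    count P? pairs                                                        ∎
    where open ≡-Reasoning

  Less : Pred (V × V) 0ℓ
  Less uv = toℕ (proj₁ uv) < toℕ (proj₂ uv)

  Less? : Decidable Less
  Less? uv = toℕ (proj₁ uv) <? toℕ (proj₂ uv)

  n*n≤2*count-Less+n : n * n ≤ 2 * count Less? pairs + n
  n*n≤2*count-Less+n = begin
    n * n                                                          ≡⟨ sumBy-vertices-const n ⟨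
    sumBy (λ _ → n) vertices                                       ≤⟨ sumBy-mono (All.universal row vertices) ⟩
    sumBy (λ u → count (λ v → Ordered? (u , v)) vertices) vertices ≡⟨ count-pairs Ordered? ⟨
    count Ordered? pairs                                           ≤⟨ count-∪ (Less? ∪? (Less? ∘ swap)) Diagonal? pairs ⟩
    count (Less? ∪? (Less? ∘ swap)) pairs + count Diagonal? pairs  ≤⟨ +-mono-≤ (count-∪ Less? (Less? ∘ swap) pairs) (≤-reflexive diagonal) ⟩
    count Less? pairs + count (Less? ∘ swap) pairs + n             ≡⟨ cong (λ c → count Less? pairs + c + n) (count-pairs-swap Less?) ⟩
    count Less? pairs + count Less? pairs + n                      ≡⟨ cong (λ c → count Less? pairs + c + n) (+-identityʳ _) ⟨
    2 * count Less? pairs + n                                      ∎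
    where
    open ≤-Reasoning
    Diagonal? : Decidable (λ (uv : V × V) → proj₁ uv ≡ proj₂ uv)
    Diagonal? uv = proj₁ uv Fin.≟ proj₂ uv
    Ordered? = (Less? ∪? (Less? ∘ swap)) ∪? Diagonal?
    trichotomy : ∀ u v → (toℕ u < toℕ v ⊎ toℕ v < toℕ u) ⊎ u ≡ v
    trichotomy u v with Fin.<-cmp u v
    ... | tri< u<v _ _ = inj₁ (inj₁ u<v)
    ... | tri≈ _ u≡v _ = inj₂ u≡v
    ... | tri> _ _ v<u = inj₁ (inj₂ v<u)
    row : ∀ u → n ≤ count (λ v → Ordered? (u , v)) vertices
    row u = ≤-reflexive (sym (trans (count-universal _ (trichotomy u) vertices) length-vertices))
    diagonal : count Diagonal? pairs ≡ n
    diagonal = trans (count-pairs Diagonal?)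
                     (trans (sumBy-cong count-≟-vertices vertices) (trans (sumBy-vertices-const 1) (*-identityʳ n)))

  Related : (V → V → Set) → Pred (V × V) 0ℓ
  Related R uv = R (proj₁ uv) (proj₂ uv)

  Related? : {R : V → V → Set} → (∀ u v → Dec (R u v)) → Decidable (Related R)
  Related? R? uv = R? (proj₁ uv) (proj₂ uv)

  module _ {R : V → V → Set} (R? : ∀ u v → Dec (R u v))
           (R-sym : ∀ {u v} → R u v → R v u) (R-refl : ∀ {u v} → R u v → R u u)
           (classes-small : ∀ u → 2 * count (R? u) vertices ≤ suc n) where

    Above? : ∀ u → Decidable (λ v → toℕ u < toℕ v × R u v)
    Above? u v = (toℕ u <? toℕ v) ×-dec R? u v

    Below? : ∀ u → Decidable (λ v → toℕ v < toℕ u × R u v)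
    Below? u v = (toℕ v <? toℕ u) ×-dec R? u v

    degree : V → ℕ
    degree u = count (Above? u) vertices + count (Below? u) vertices

    degree≤count-above∪below : ∀ u → degree u ≤ count (Above? u ∪? Below? u) vertices
    degree≤count-above∪below u = count-∪-disjoint (Above? u) (Below? u) (λ (u<v , _) (v<u , _) → <-asym u<v v<u) vertices

    degree≤class : ∀ u → degree u ≤ count (R? u) vertices
    degree≤class u = ≤-trans (degree≤count-above∪below u) (count-mono _ (R? u) [ proj₂ , proj₂ ] vertices)

    degree<class : ∀ u → R u u → degree u + 1 ≤ count (R? u) vertices
    degree<class u Ruu = begin
      degree u + 1                                                      ≡⟨ cong (degree u +_) (count-≟-vertices u) ⟨
      degree u + count (u Fin.≟_) vertices                              ≤⟨ +-monoˡ-≤ _ (degree≤count-above∪below u) ⟩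
      count (Above? u ∪? Below? u) vertices + count (u Fin.≟_) vertices ≤⟨ count-∪-disjoint _ (u Fin.≟_) off-diagonal vertices ⟩
      count ((Above? u ∪? Below? u) ∪? (u Fin.≟_)) vertices             ≤⟨ count-mono _ (R? u) [ [ proj₂ , proj₂ ] , (λ { refl → Ruu }) ] vertices ⟩
      count (R? u) vertices                                             ∎
      where
      open ≤-Reasoning
      off-diagonal : ∀ {v} → (toℕ u < toℕ v × R u v) ⊎ (toℕ v < toℕ u × R u v) → u ≢ v
      off-diagonal (inj₁ (u<v , _)) refl = <-irrefl refl u<v
      off-diagonal (inj₂ (v<u , _)) refl = <-irrefl refl v<u

    2*degree+1≤n : ∀ u → 2 * degree u + 1 ≤ n
    2*degree+1≤n u with R? u u
    ... | yes Ruu = ≤-pred (begin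
      suc (2 * degree u + 1)    ≡⟨ regroup (degree u) ⟩
      2 * (degree u + 1)        ≤⟨ *-monoʳ-≤ 2 (degree<class u Ruu) ⟩
      2 * count (R? u) vertices ≤⟨ classes-small u ⟩
      suc n                     ∎)
      where
      open ≤-Reasoning
      regroup : ∀ d → suc (2 * d + 1) ≡ 2 * (d + 1)
      regroup = solve-∀
    ... | no ¬Ruu = begin
      2 * degree u + 1  ≤⟨ +-monoˡ-≤ 1 (*-monoʳ-≤ 2 (≤-trans (degree≤class u) (≤-reflexive empty-class))) ⟩
      1                 ≤⟨ ≤-trans (s≤s z≤n) (Fin.toℕ<n u) ⟩
      n                 ∎
      where
      open ≤-Reasoning
      empty-class : count (R? u) vertices ≡ 0
      empty-class = cong length (filter-none (R? u) (All.universal (λ v Ruv → ¬Ruu (R-refl Ruv)) vertices))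

    private
      related = count (Less? ∩? Related? R?) pairs
      unrelated = count (Less? ∩? ∁? (Related? R?)) pairs

    2*related≤nC2 : related + related ≤ n C 2
    2*related≤nC2 = *-cancelˡ-≤ 2 (+-cancelʳ-≤ n _ _ (begin
      2 * (related + related) + n                                       ≤⟨ +-monoˡ-≤ n (*-monoʳ-≤ 2 (+-monoʳ-≤ related related≤reversed)) ⟩
      2 * (related + reversed) + n                                      ≡⟨ cong (λ d → 2 * d + n) degree-sum ⟨
      2 * sumBy degree vertices + n                                     ≡⟨ cong₂ _+_ (*-distribˡ-sumBy 2 degree vertices)
                                                                                     (trans (sym (*-identityʳ n)) (sym (sumBy-vertices-const 1))) ⟩
      sumBy (λ u → 2 * degree u) vertices + sumBy (λ _ → 1) vertices    ≡⟨ sumBy-+ (λ u → 2 * degree u) (λ _ → 1) vertices ⟨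
      sumBy (λ u → 2 * degree u + 1) vertices                           ≤⟨ sumBy-mono (All.universal 2*degree+1≤n vertices) ⟩
      sumBy (λ _ → n) vertices                                          ≡⟨ sumBy-vertices-const n ⟩
      n * n                                                             ≡⟨ 2*nC2+n≡n*n n ⟨
      2 * (n C 2) + n                                                   ∎))
      where
      open ≤-Reasoning
      reversed = count ((Less? ∘ swap) ∩? Related? R?) pairs
      related≤reversed : related ≤ reversed
      related≤reversed = begin
        related                                      ≡⟨ count-pairs-swap (Less? ∩? Related? R?) ⟨
        count ((Less? ∩? Related? R?) ∘ swap) pairs  ≤⟨ count-mono ((Less? ∩? Related? R?) ∘ swap) _ (λ (v<u , Rvu) → v<u , R-sym Rvu) pairs ⟩
        reversed                                     ∎
      degree-sum : sumBy degree vertices ≡ related + reversed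
      degree-sum = trans (sumBy-+ (λ u → count (Above? u) vertices) (λ u → count (Below? u) vertices) vertices)
                         (sym (cong₂ _+_ (count-pairs (Less? ∩? Related? R?)) (count-pairs ((Less? ∘ swap) ∩? Related? R?))))

    nC2≤unrelated+related : n C 2 ≤ unrelated + related
    nC2≤unrelated+related = *-cancelˡ-≤ 2 (+-cancelʳ-≤ n _ _ (begin
      2 * (n C 2) + n                ≡⟨ 2*nC2+n≡n*n n ⟩
      n * n                          ≤⟨ n*n≤2*count-Less+n ⟩
      2 * count Less? pairs + n      ≤⟨ +-monoˡ-≤ n (*-monoʳ-≤ 2 less≤unrelated+related) ⟩
      2 * (unrelated + related) + n  ∎))
      where
      open ≤-Reasoning
      split : ∀ {uv} → Less uv → (Less uv × ¬ Related R uv) ⊎ (Less uv × Related R uv)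
      split {uv} l with Related? R? uv
      ... | yes r = inj₂ (l , r)
      ... | no ¬r = inj₁ (l , ¬r)
      less≤unrelated+related : count Less? pairs ≤ unrelated + related
      less≤unrelated+related = ≤-trans (count-mono Less? _ split pairs) (count-∪ (Less? ∩? ∁? (Related? R?)) (Less? ∩? Related? R?) pairs)

    nC2≤2*unrelated : n C 2 ≤ 2 * count (Less? ∩? ∁? (Related? R?)) pairs
    nC2≤2*unrelated = half-bound {g = unrelated} nC2≤unrelated+related 2*related≤nC2

¬¬-Π : ∀ {m} {P : Fin m → Set} → (∀ i → ¬ ¬ P i) → ¬ ¬ (∀ i → P i)
¬¬-Π {zero}  _   k = k (λ ())
¬¬-Π {suc m} ¬¬P k = ¬¬P zero (λ p₀ → ¬¬-Π (¬¬P ∘ suc) (λ ps → k (λ { zero → p₀ ; (suc i) → ps i })))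

T-∧⁻ : ∀ a {b} → T (a ∧ b) → T a × T b
T-∧⁻ a = to (T-∧ {a})

¬T⇒T-not : ∀ {b} → ¬ T b → T (not b)
¬T⇒T-not {false} _  = _
¬T⇒T-not {true}  ¬t = ¬t _

module _ {n : ℕ} (G : SimpleGraph n) where

  private
    V = Fin n

  inClosedNbhd : V → V → Bool
  inClosedNbhd w x = _=ᵇ_ G w x ∨ adj G w x

  ≡⇒inClosedNbhd : ∀ {w x} → w ≡ x → T (inClosedNbhd w x)
  ≡⇒inClosedNbhd {w} refl = from (T-∨ {_=ᵇ_ G w w}) (inj₁ (fromWitness refl))

  adj⇒inClosedNbhd : ∀ {w x} → T (adj G w x) → T (inClosedNbhd w x)
  adj⇒inClosedNbhd {w} {x} wx = from (T-∨ {_=ᵇ_ G w x}) (inj₂ wx)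

  N[_] : List V → V → Bool
  N[ Q ] x = any (λ q → inClosedNbhd q x) Q

  N[]-head : ∀ {h rest x} → T (inClosedNbhd h x) → T (N[ h ∷ rest ] x)
  N[]-head {h} {x = x} = from (T-∨ {inClosedNbhd h x}) ∘ inj₁

  N[]-tail : ∀ {h rest x} → T (N[ rest ] x) → T (N[ h ∷ rest ] x)
  N[]-tail {h} {x = x} = from (T-∨ {inClosedNbhd h x}) ∘ inj₂

  data Reach (X : V → Bool) : V → V → Set where
    stop : ∀ {u} → ¬ T (X u) → Reach X u u
    step : ∀ {u w v} → ¬ T (X u) → T (adj G u w) → Reach X w v → Reach X u v

  module _ {X : V → Bool} where

    reach-source∉ : ∀ {u v} → Reach X u v → ¬ T (X u)
    reach-source∉ (stop ¬Xu)     = ¬Xu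
    reach-source∉ (step ¬Xu _ _) = ¬Xu

    reach-target∉ : ∀ {u v} → Reach X u v → ¬ T (X v)
    reach-target∉ (stop ¬Xv)   = ¬Xv
    reach-target∉ (step _ _ r) = reach-target∉ r

    reach-trans : ∀ {u w v} → Reach X u w → Reach X w v → Reach X u v
    reach-trans (stop _)       r′ = r′
    reach-trans (step ¬Xu uw r) r′ = step ¬Xu uw (reach-trans r r′)

    reach-sym : ∀ {u v} → Reach X u v → Reach X v u
    reach-sym (stop ¬Xu) = stop ¬Xu
    reach-sym {u} (step {w = w} ¬Xu uw r) = reach-trans (reach-sym r) (step (reach-source∉ r) (subst T (adj-sym G u w) uw) (stop ¬Xu))

    reach-refl : ∀ {u v} → Reach X u v → Reach X u u
    reach-refl r = stop (reach-source∉ r)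

  reach-antitone : ∀ {X Y : V → Bool} → (∀ {x} → T (X x) → T (Y x)) → ∀ {u v} → Reach Y u v → Reach X u v
  reach-antitone X⊆Y (stop ¬Yu)      = stop (¬Yu ∘ X⊆Y)
  reach-antitone X⊆Y (step ¬Yu uw r) = step (¬Yu ∘ X⊆Y) uw (reach-antitone X⊆Y r)

  reach-lastExit : ∀ {X} (Y : V → Bool) {s t} → Reach X s t → ¬ T (Y t) →
                   Reach Y s t ⊎ ∃[ x ] ∃[ z ] (T (Y x) × Reach X s x × T (adj G x z) × Reach Y z t)
  reach-lastExit Y (stop ¬Xt) ¬Yt = inj₁ (stop ¬Yt)
  reach-lastExit Y {s} (step {w = w} ¬Xs sw r) ¬Yt with reach-lastExit Y r ¬Yt
  ... | inj₂ (x , z , Yx , s→x , xz , z→t) = inj₂ (x , z , Yx , step ¬Xs sw s→x , xz , z→t)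
  ... | inj₁ w→t with T? (Y s)
  ...   | yes Ys  = inj₂ (s , w , Ys , stop ¬Xs , sw , w→t)
  ...   | no ¬Ys = inj₁ (step ¬Ys sw w→t)

  induced⇒walk : ∀ p → T (isInducedPath G p) → T (isWalk G p)
  induced⇒walk (x ∷ [])     _  = _
  induced⇒walk (x ∷ y ∷ xs) ip =
    let _ , ip₁  = T-∧⁻ (not (any (_=ᵇ_ G x) (y ∷ xs))) ip
        xy , ip₂ = T-∧⁻ (adj G x y) ip₁
        _ , ip₃  = T-∧⁻ (all (λ z → not (adj G x z)) xs) ip₂
    in from T-∧ (xy , induced⇒walk (y ∷ xs) ip₃)

  walk⇒reach⊎meets : (X : V → Bool) → ∀ p {u v} → T (isWalk G p) → T (startsAt G u p) → T (endsAt G v p) →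
                     Reach X u v ⊎ Any (T ∘ X) p
  walk⇒reach⊎meets X (x ∷ []) _ u=x v=x with T? (X x)
  ... | yes Xx  = inj₂ (here Xx)
  ... | no ¬Xx rewrite toWitness u=x | toWitness v=x = inj₁ (stop ¬Xx)
  walk⇒reach⊎meets X (x ∷ y ∷ xs) {v = v} w u=x v-end
    with T? (X x) | walk⇒reach⊎meets X (y ∷ xs) {y} (proj₂ (T-∧⁻ (adj G x y) w)) (fromWitness refl) v-end
  ... | yes Xx  | _          = inj₂ (here Xx)
  ... | no _    | inj₂ meets = inj₂ (there meets)
  ... | no ¬Xx  | inj₁ y→v   = inj₁ (subst (λ u → Reach X u v) (sym (toWitness u=x)) (step ¬Xx (proj₁ (T-∧⁻ (adj G x y) w)) y→v))

  extend-induced : ∀ {x h rest} → T (isInducedPath G (h ∷ rest)) → T (adj G h x) → x ≢ h → ¬ T (N[ rest ] x) →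
                   T (isInducedPath G (x ∷ h ∷ rest))
  extend-induced {x} {h} {rest} ip hx x≢h x∉N[rest] =
    from T-∧ (¬T⇒T-not fresh , from T-∧ (subst T (adj-sym G h x) hx , from T-∧ (nonadjacent , ip)))
    where
    far : All (λ r → ¬ T (inClosedNbhd r x)) rest
    far = ¬Any⇒All¬ rest (x∉N[rest] ∘ any⁺ _)
    fresh : ¬ T (any (_=ᵇ_ G x) (h ∷ rest))
    fresh x∈ with any⁻ _ (h ∷ rest) x∈
    ... | here x=h     = x≢h (toWitness x=h)
    ... | there x∈rest = All.lookupWith (λ ¬near x=r → ¬near (≡⇒inClosedNbhd (sym (toWitness x=r)))) far x∈rest
    nonadjacent : T (all (λ z → not (adj G x z)) rest)
    nonadjacent = all⁻ _ (All.map (λ {r} ¬near → ¬T⇒T-not (λ xr → ¬near (adj⇒inClosedNbhd (subst T (adj-sym G x r) xr)))) far)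

  Decider : (V → Bool) → Set
  Decider X = ∀ u v → Dec (Reach X u v)

  Big : ∀ {X} → Decider X → V → Set
  Big D b = suc n < 2 * count (D b) (allFin n)

  Big? : ∀ {X} (D : Decider X) → Decidable (Big D)
  Big? D b = suc n <? 2 * count (D b) (allFin n)

  big⇒∉ : ∀ {X} (D : Decider X) {b} → Big D b → ¬ T (X b)
  big⇒∉ D {b} big Xb = <⇒≱ big (subst (λ c → 2 * c ≤ suc n) (sym empty) z≤n)
    where
    empty : count (D b) (allFin n) ≡ 0
    empty = cong length (filter-none (D b) (All.universal (λ v b→v → reach-source∉ b→v Xb) (allFin n)))

  big-antitone : ∀ {X Y} → (∀ {x} → T (X x) → T (Y x)) → (DX : Decider X) (DY : Decider Y) →
                 ∀ {b} → Big DY b → Big DX b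
  big-antitone X⊆Y DX DY {b} big = <-≤-trans big (*-monoʳ-≤ 2 (count-mono (DY b) (DX b) (reach-antitone X⊆Y) (allFin n)))

  bigs-connected : ∀ {X} (D : Decider X) {b b′} → Big D b → Big D b′ → Reach X b b′
  bigs-connected D {b} {b′} big big′ with Fin.any? (λ v → D b v ×-dec D b′ v)
  ... | yes (v , b→v , b′→v) = reach-trans b→v (reach-sym b′→v)
  ... | no disjoint = contradiction
    (≤-trans (count-∪-disjoint (D b) (D b′) (λ b→v b′→v → disjoint (_ , b→v , b′→v)) (allFin n))
             (≤-trans (length-filter (D b ∪? D b′) (allFin n)) (≤-reflexive (length-tabulate {n = n} (λ v → v)))))
    (halves-overlap {c = count (D b) (allFin n)} {c′ = count (D b′) (allFin n)} big big′)

  -- The path is h ∷ rest, grown at h; the anchor is a vertex of N[h] in the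
  -- (unique) big component of G − N[rest].
  record GyarfasPath (h : V) (rest : List V) (D : Decider N[ rest ]) : Set where
    field
      induced     : T (isInducedPath G (h ∷ rest))
      anchor      : V
      anchor-near : T (inClosedNbhd h anchor)
      anchor-big  : ∀ {b} → Big D b → Reach N[ rest ] anchor b

  initial-path : Connected G → (v : V) (D : Decider N[ [] ]) → GyarfasPath v [] D
  initial-path connected v D = record
    { induced = _ ; anchor = v ; anchor-near = ≡⇒inClosedNbhd refl ; anchor-big = λ {b} _ → reach b }
    where
    reach : ∀ b → Reach N[ [] ] v b
    reach b with connected v b
    ... | p , walk , start , end with walk⇒reach⊎meets N[ [] ] p walk start end
    ...   | inj₁ v→b  = v→b
    ...   | inj₂ meets = ⊥-elim (proj₂ (Any.satisfied meets))

  extend : ∀ {h rest} {DX : Decider N[ rest ]} → GyarfasPath h rest DX →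
           (DY : Decider N[ h ∷ rest ]) → ∀ {a} → Big DY a → ∃[ x ] GyarfasPath x (h ∷ rest) DY
  extend {h} {rest} {DX} P DY {a} big
    with reach-lastExit N[ h ∷ rest ] (GyarfasPath.anchor-big P (big-antitone (N[]-tail {h} {rest}) DX DY big)) (big⇒∉ DY big)
  ... | inj₁ anchor→a = contradiction (N[]-head {h} {rest} (GyarfasPath.anchor-near P)) (reach-source∉ anchor→a)
  ... | inj₂ (x , z , x∈Y , anchor→x , xz , z→a) = x , record
    { induced     = extend-induced {x} {h} {rest} (GyarfasPath.induced P) hx x≢h x∉N[rest]
    ; anchor      = z
    ; anchor-near = adj⇒inClosedNbhd xz
    ; anchor-big  = λ big′ → reach-trans z→a (bigs-connected DY big big′)
    }
    where
    x∉N[rest] : ¬ T (N[ rest ] x)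
    x∉N[rest] = reach-target∉ anchor→x
    x≢h : x ≢ h
    x≢h refl = reach-source∉ z→a (N[]-head {h} {rest} (adj⇒inClosedNbhd xz))
    hx : T (adj G h x)
    hx with to (T-∨ {inClosedNbhd h x}) x∈Y
    ... | inj₂ x∈N[rest] = contradiction x∈N[rest] x∉N[rest]
    ... | inj₁ x∈N[h] with to (T-∨ {_=ᵇ_ G h x}) x∈N[h]
    ...   | inj₁ h=x = contradiction (sym (toWitness h=x)) x≢h
    ...   | inj₂ hx  = hx

  module _ (t : ℕ) {h : V} {rest : List V} (short : length (h ∷ rest) ≤ t) where

    private
      Q = h ∷ rest

    bucket-meets-N[Q] : ∀ {u v} → ¬ Reach N[ Q ] u v →
                        All (λ p → Any (λ q → T (closedNbhdMeets G q p)) Q) (bucket G u v)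
    bucket-meets-N[Q] {u} {v} ¬u→v =
      All.map (λ {p} → meets p) (all-filter (λ p → T? (isInducedPath G p ∧ startsAt G u p ∧ endsAt G v p)) (candidates G))
      where
      meets : ∀ p → T (isInducedPath G p ∧ startsAt G u p ∧ endsAt G v p) → Any (λ q → T (closedNbhdMeets G q p)) Q
      meets p ip-s-e with T-∧⁻ (isInducedPath G p) ip-s-e
      ... | ip , s-e with T-∧⁻ (startsAt G u p) s-e
      ...   | s , e with walk⇒reach⊎meets N[ Q ] p (induced⇒walk p ip) s e
      ...     | inj₁ u→v    = contradiction u→v ¬u→v
      ...     | inj₂ p∩N[Q] = Any.map (any⁺ _) (Any-swap (Any.map (any⁻ _ Q) p∩N[Q]))

    separated⇒hit : ∀ {u v} → ¬ Reach N[ Q ] u v → Any (λ q → hits G t q u v) Q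
    separated⇒hit {u} {v} ¬u→v = lose (argmax∈ (λ q → hitCount G q u v) h rest) (begin
      length (bucket G u v)                         ≡⟨ count-universal (λ _ → yes tt) (λ _ → tt) (bucket G u v) ⟨
      count (λ _ → yes tt) (bucket G u v)           ≤⟨ count≤sumBy-count _ (λ q p → T? (closedNbhdMeets G q p)) Q
                                                         (All.map (λ meets _ → meets) (bucket-meets-N[Q] ¬u→v)) ⟩
      sumBy (λ q → hitCount G q u v) Q              ≤⟨ sumBy≤length*argmax (λ q → hitCount G q u v) h rest ⟩
      length Q * hitCount G w u v                   ≤⟨ *-monoˡ-≤ (hitCount G w u v) (≤-trans short (m≤m+n t (t + 0))) ⟩
      (2 * t) * hitCount G w u v                    ∎)
      where
      open ≤-Reasoning
      w = argmax (λ q → hitCount G q u v) h rest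

    no-big⇒heavy : (D : Decider N[ Q ]) → (∀ b → ¬ Big D b) → ∃[ w ] heavy G t w
    no-big⇒heavy D no-big = w , (begin
      n C 2                                           ≤⟨ nC2≤2*unrelated D reach-sym reach-refl (λ u → ≮⇒≥ (no-big u)) ⟩
      2 * count (Less? ∩? ∁? (Related? D)) pairs      ≤⟨ *-monoʳ-≤ 2 (count≤sumBy-count _ HitsLess? Q
                                                           (All.universal (λ _ (l , ¬u→v) → Any.map (l ,_) (separated⇒hit ¬u→v)) pairs)) ⟩
      2 * sumBy (hitBucketCount G t) Q                ≤⟨ *-monoʳ-≤ 2 (sumBy≤length*argmax (hitBucketCount G t) h rest) ⟩
      2 * (length Q * hitBucketCount G t w)           ≤⟨ *-monoʳ-≤ 2 (*-monoˡ-≤ (hitBucketCount G t w) short) ⟩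
      2 * (t * hitBucketCount G t w)                  ≡⟨ *-assoc 2 t _ ⟨
      (2 * t) * hitBucketCount G t w                  ∎)
      where
      open ≤-Reasoning
      w = argmax (hitBucketCount G t) h rest
      HitsLess? : ∀ q → Decidable (λ (uv : V × V) → Less uv × hits G t q (proj₁ uv) (proj₂ uv))
      HitsLess? q uv = Less? uv ×-dec (length (bucket G (proj₁ uv) (proj₂ uv)) ≤? (2 * t) * hitCount G q (proj₁ uv) (proj₂ uv))

  ¬¬-decider : (X : V → Bool) → ¬ ¬ Decider X
  ¬¬-decider X = ¬¬-Π (λ u → ¬¬-Π (λ v → ¬¬-excluded-middle))

  grow : ∀ t → PFree G t → ∀ k {h rest} {D : Decider N[ rest ]} → length (h ∷ rest) + k ≡ t →
         GyarfasPath h rest D → ¬ ¬ (∃[ w ] heavy G t w)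
  grow t P-free zero {h} {rest} path≡t P _ = P-free (h ∷ rest) (GyarfasPath.induced P) (trans (sym (+-identityʳ _)) path≡t)
  grow t P-free (suc k) {h} {rest} path≡t P ¬heavy = ¬¬-decider N[ h ∷ rest ] next
    where
    longer≡t : suc (length (h ∷ rest)) + k ≡ t
    longer≡t = trans (sym (+-suc (length (h ∷ rest)) k)) path≡t
    short : length (h ∷ rest) ≤ t
    short = ≤-trans (m≤m+n (length (h ∷ rest)) (suc k)) (≤-reflexive path≡t)
    next : Decider N[ h ∷ rest ] → ⊥
    next D with Fin.any? (Big? D)
    ... | yes (_ , big) = grow t P-free k longer≡t (proj₂ (extend P D big)) ¬heavy
    ... | no no-big     = ¬heavy (no-big⇒heavy t {h} {rest} short D (λ b big → no-big (b , big)))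

lemma4 : (t n : ℕ) → 1 ≤ t → 1 ≤ n → (G : SimpleGraph n) →
  Connected G → PFree G t → Σ (Fin n) (λ w → heavy G t w)
lemma4 t n 1≤t 1≤n G connected P-free =
  decidable-stable (Fin.any? (λ w → n C 2 ≤? (2 * t) * hitBucketCount G t w)) λ ¬heavy →
    ¬¬-decider G (N[_] G []) λ D →
      grow G t P-free (t ∸ 1) (m+[n∸m]≡n 1≤t) (initial-path G connected (fromℕ< 1≤n) D) ¬heavy
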